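{- Let $v_0\in L_{d-1}$ and let $\mathcal{F}$ be the set of centered legal labelings of $L_{d-1}$. Then every $f\in\mathcal{F}$ belongs to $\mathcal{F}_\ell$ for some integer $0\le\ell\le\ell_0:=d^2\binom{2d-1}{d}$.
   Context: $Q^{\mathrm{mid}}_{2d-1}$ is the subgraph of the Hamming cube $\{0,1\}^{2d-1}$ induced on $L_{d-1}\cup L_d$ ($L_k$ = vectors with exactly $k$ ones); neighborhoods and distances are in this graph; $N^2(A)=N(N(A))$. A legal labeling of $L_{d-1}$ is $f:L_{d-1}\to\mathbb{Z}$ with $|f(u)-f(w)|\le1$ whenever $\mathrm{dist}(u,w)=2$; centered means $f(v_0)=0$. For $A\subseteq L_{d-1}$, $[A]=\{v\in L_{d-1}:N(v)\subseteq N(A)\}$. $K$ is $2$-linked if any two of its vertices are joined by a sequence in $K$ with consecutive distances $\le2$; $K\subseteq L_{d-1}$ is a maximum component of $f$ if $K$ is $2$-linked and $f(y)<f(x)$ for all $x\in K$, $y\in N^2(K)\setminus K$. The merge $m_K(f)$ equals $f-1$ on $K$ and $f$ off $K$ if $v_0\notin K$, and equals $f$ on $K$ and $f+1$ off $K$ if $v_0\in K$. $f$ is max-good if there is no maximum component $K$ with $|K|\ge d/2$ and $|[K]|\le\frac{9}{10}\binom{2d-1}{d}$; $\mathcal{F}_0$ is the set of centered max-good legal labelings. For $\ell\ge1$, $f\in\mathcal{F}_\ell$ if there exist $f_0=f,f_1,\dots,f_\ell$ with $f_\ell\in\mathcal{F}_0$ and, for each $0\le i\le\ell-1$, $f_{i+1}=m_{K_i}(f_i)$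 where $K_i$ is a maximum component of $f_i$ with $|K_i|\ge d/2$ and $|[K_i]|\le\frac{9}{10}\binom{2d-1}{d}$. -}

module Defs where

open import Data.Bool using (Bool; true; false; if_then_else_; _∧_; _∨_; not)
open import Data.Nat using (ℕ; zero; suc; _+_; _*_; _∸_; _^_; _≤_; _≡ᵇ_)
open import Data.Nat.Properties using (_≟_)
open import Data.Nat.Combinatorics using (_C_)
open import Data.Integer as ℤ using (ℤ; ∣_∣; 0ℤ; 1ℤ)
open import Data.Vec using (Vec; []; _∷_)
open import Data.List using (List; []; _∷_; _++_; map; mapMaybe; length; filterᵇ)
open import Data.Bool.ListAction using (any; all)
open import Data.Maybe using (Maybe; just; nothing)
open import Data.Product using (Σ; _×_; _,_; proj₁)
open import Data.Sum using (_⊎_; inj₁; inj₂)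
open import Relation.Nullary using (¬_; yes; no)
open import Relation.Binary.PropositionalEquality using (_≡_)

ones : ∀ {n} → Vec Bool n → ℕ
ones [] = 0
ones (b ∷ v) = (if b then 1 else 0) + ones v

hamming : ∀ {n} → Vec Bool n → Vec Bool n → ℕ
hamming [] [] = 0
hamming (a ∷ u) (b ∷ w) = (if (a ∧ not b) ∨ (b ∧ not a) then 1 else 0) + hamming u w

allVecs : ∀ n → List (Vec Bool n)
allVecs zero = [] ∷ []
allVecs (suc n) = map (true ∷_) (allVecs n) ++ map (false ∷_) (allVecs n)

dim : ℕ → ℕ
dim d = 2 * d ∸ 1

Cube : ℕ → Set
Cube d = Vec Bool (dim d)

module _ (d : ℕ) where

  InMid : Cube d → Set
  InMid v = ones v ≡ d ∸ 1 ⊎ ones v ≡ d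

  inMidᵇ : Cube d → Bool
  inMidᵇ v = (ones v ≡ᵇ d ∸ 1) ∨ (ones v ≡ᵇ d)

  Mid : Set
  Mid = Σ (Cube d) InMid

  Adj : Mid → Mid → Set
  Adj u w = hamming (proj₁ u) (proj₁ w) ≡ 1

  adjᵇ : Cube d → Cube d → Bool
  adjᵇ u w = hamming u w ≡ᵇ 1

  Dist2 : Mid → Mid → Set
  Dist2 u w = ¬ (proj₁ u ≡ proj₁ w) × ¬ Adj u w × Σ (Mid) (λ z → Adj u z × Adj z w)

  DistLe2 : Mid → Mid → Set
  DistLe2 u w = proj₁ u ≡ proj₁ w ⊎ Adj u w ⊎ Σ (Mid) (λ z → Adj u z × Adj z w)

  Low : Set
  Low = Σ (Cube d) (λ v → ones v ≡ d ∸ 1)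

  low→mid : Low → Mid
  low→mid (v , p) = v , inj₁ p

  toLow : Cube d → Maybe (Low)
  toLow v with ones v ≟ d ∸ 1
  ... | yes p = just (v , p)
  ... | no _ = nothing

  -- enumeration of L_{d-1} (each element exactly once)
  lowList : List (Low)
  lowList = mapMaybe (toLow) (allVecs (dim d))

  LowSet : Set
  LowSet = Low → Bool

  size : LowSet → ℕ
  size K = length (filterᵇ K lowList)

  NBᵇ : LowSet → Cube d → Bool
  NBᵇ K w = inMidᵇ w ∧ any (λ x → K x ∧ adjᵇ (proj₁ x) w) lowList

  N2ᵇ : LowSet → Low → Bool
  N2ᵇ K y = any (λ w → NBᵇ K w ∧ adjᵇ w (proj₁ y)) (allVecs (dim d))

  closure : LowSet → LowSet
  closure K v =
    all (λ w → not (inMidᵇ w ∧ adjᵇ (proj₁ v) w) ∨ NBᵇ K w) (allVecs (dim d))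

  Labeling : Set
  Labeling = Low → ℤ

  Legal : Labeling → Set
  Legal f = (u w : Low) → Dist2 (low→mid u) (low→mid w) → ∣ f u ℤ.- f w ∣ ≤ 1

  Centered : Low → Labeling → Set
  Centered v₀ f = f v₀ ≡ 0ℤ

  data Chain (K : LowSet) : Low → Low → Set where
    done : ∀ {x} → Chain K x x
    step : ∀ {x z y} → DistLe2 (low→mid x) (low→mid z) → K z ≡ true →
           Chain K z y → Chain K x y

  TwoLinked : LowSet → Set
  TwoLinked K = (x y : Low) → K x ≡ true → K y ≡ true → Chain K x y

  MaxComponent : Labeling → LowSet → Set
  MaxComponent f K =
    TwoLinked K ×
    ((x y : Low) → K x ≡ true → N2ᵇ K y ≡ true → K y ≡ false → f y ℤ.< f x)

  -- a maximum component K with |K| ≥ d/2 and |[K]| ≤ (9/10) binom(2d-1,d)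
  -- (inequalities cleared of denominators)
  BigMaxComponent : Labeling → LowSet → Set
  BigMaxComponent f K =
    MaxComponent f K × d ≤ 2 * size K × 10 * size (closure K) ≤ 9 * (dim d C d)

  MaxGood : Labeling → Set
  MaxGood f = (K : LowSet) → ¬ BigMaxComponent f K

  merge : Low → LowSet → Labeling → Labeling
  merge v₀ K f x with K v₀ | K x
  ... | false | true  = f x ℤ.- 1ℤ
  ... | false | false = f x
  ... | true  | true  = f x
  ... | true  | false = f x ℤ.+ 1ℤ

  F₀ : Low → Labeling → Set
  F₀ v₀ f = Centered v₀ f × Legal f × MaxGood f

  data F (v₀ : Low) : ℕ → Labeling → Set where
    base  : ∀ {f} → F₀ v₀ f → F v₀ 0 f
    mstep : ∀ {ℓ f} (K : LowSet) → BigMaxComponent f K →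
            F v₀ ℓ (merge v₀ K f) → F v₀ (suc ℓ) f

-- Up to an additive constant, the merge m_K lowers the labels on K by one.  Fix a global
-- minimum w of the initial labeling and use as potential the sum over L_{d-1} of the heights
-- f x - f w.  A big maximum component K contains a vertex and misses one (otherwise [K] would
-- be all of L_{d-1}); a walk with steps of length 2 between them leaves K at some
-- b ∈ N²(K) ∖ K, and f b < f x for every x ∈ K.  Hence w ∉ K, w stays a minimum after the
-- merge, and the potential drops by |K| ≥ 1.  Legality survives because across the boundary
-- of K the labels drop by exactly one.  Walks of at most 2d - 1 such steps join any two
-- vertices, so heights are at most 2d - 1 and the initial potential is at most
-- (2d - 1) binom(2d-1, d) ≤ d² binom(2d-1, d).  Finally, whether a big maximum component
-- exists is decidable: each maximum component is the 2-linked component of its lowest point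
-- within the superlevel set of that point, so only finitely many computable candidates need
-- checking.
module Submission where

open import Defs
open import Data.Bool as Bool using (Bool; true; false; not; _∧_; _∨_; if_then_else_)
open import Data.Bool.Properties using (T-≡; ∨-zeroʳ)
open import Data.Bool.ListAction using (any; all; or; and)
open import Data.Empty using (⊥-elim)
open import Data.Integer as ℤ using (ℤ; +_; ∣_∣; 0ℤ; 1ℤ)
import Data.Integer.Properties as ℤ
open import Data.Integer.Tactic.RingSolver using (solve-∀)
open import Data.List using (List; []; _∷_; _++_; map; mapMaybe; length; filterᵇ)
open import Data.List.Extrema ℤ.≤-totalOrder using (argmin; argmin-all; f[argmin]≤f[xs])
open import Data.List.Membership.Propositional using (_∈_; lose; find)
open import Data.List.Membership.Propositional.Properties
  using (∈-++⁺ˡ; ∈-++⁺ʳ; ∈-map⁺; ∈-length; ∈-filter⁺)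
open import Data.List.Properties using (length-++; filter-++; filter-all; map-cong)
open import Data.List.Relation.Unary.All as All using (All)
open import Data.List.Relation.Unary.All.Properties using (all⁻; all-filter)
open import Data.List.Relation.Unary.Any as Any using (here; there)
open import Data.List.Relation.Unary.Any.Properties using (any⁺; any⁻; map⁺; mapMaybe⁺)
open import Data.Maybe using (Maybe; just; nothing; is-just)
import Data.Maybe.Relation.Unary.Any as MaybeAny
open import Data.Nat
open import Data.Nat.Combinatorics using (_C_; nCk+nC[k+1]≡[n+1]C[k+1]; nCk≡nC[n∸k])
open import Data.Nat.ListAction using (sum)
open import Data.Nat.Properties
open import Data.Product using (Σ; ∃-syntax; _×_; _,_; proj₁; proj₂)
open import Data.Sum using (_⊎_; inj₁; inj₂)
open import Data.Vec using (Vec; []; _∷_)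
open import Data.Vec.Properties using (≡-dec)
open import Function using (_∘_; id)
open import Function.Bundles using (Equivalence)
open import Relation.Binary.Definitions using (DecidableEquality)
open import Relation.Binary.PropositionalEquality
open import Relation.Nullary using (Dec; yes; no; does)
open import Relation.Nullary.Decidable using (T?; dec-true; dec-false; _×-dec_; _→-dec_; map′)

open Equivalence using (to; from)

indicator : Bool → ℕ
indicator b = if b then 1 else 0

true≢false : true ≢ false
true≢false ()

∧-intro : ∀ {a b} → a ≡ true → b ≡ true → a ∧ b ≡ true
∧-intro refl refl = refl

∧-elim : ∀ {a b} → a ∧ b ≡ true → a ≡ true × b ≡ true
∧-elim {true} b≡true = refl , b≡true

∨-introˡ : ∀ {a} b → a ≡ true → a ∨ b ≡ true
∨-introˡ _ refl = refl

∨-introʳ : ∀ a {b} → b ≡ true → a ∨ b ≡ true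
∨-introʳ a refl = ∨-zeroʳ a

∨-elim : ∀ {a b} → a ∨ b ≡ true → a ≡ true ⊎ b ≡ true
∨-elim {true}  _      = inj₁ refl
∨-elim {false} b≡true = inj₂ b≡true

module _ {A : Set} where

  does-sound : (a? : Dec A) → does a? ≡ true → A
  does-sound (yes a) _ = a

  _⊆ᵇ_ : (A → Bool) → (A → Bool) → Set
  P ⊆ᵇ Q = ∀ x → P x ≡ true → Q x ≡ true

  ⊆ᵇ-antisym : ∀ {P Q : A → Bool} → P ⊆ᵇ Q → Q ⊆ᵇ P → ∀ x → P x ≡ Q x
  ⊆ᵇ-antisym {P} {Q} P⊆Q Q⊆P x with P x in Px | Q x in Qx
  ... | true  | true  = refl
  ... | false | false = refl
  ... | true  | false = trans (sym (P⊆Q x Px)) Qx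
  ... | false | true  = trans (sym Px) (Q⊆P x Qx)

≡ᵇ-sound : ∀ {m n} → (m ≡ᵇ n) ≡ true → m ≡ n
≡ᵇ-sound {m} {n} = does-sound (m ≟ n)

≡ᵇ-complete : ∀ {m n} → m ≡ n → (m ≡ᵇ n) ≡ true
≡ᵇ-complete {m} {n} = dec-true (m ≟ n)

module _ {A : Set} (p : A → Bool) where

  any-intro : ∀ {x xs} → x ∈ xs → p x ≡ true → any p xs ≡ true
  any-intro x∈xs px = to T-≡ (any⁺ p (lose x∈xs (from T-≡ px)))

  any-elim : ∀ xs → any p xs ≡ true → ∃[ x ] x ∈ xs × p x ≡ true
  any-elim xs pxs with find (any⁻ p xs (from T-≡ pxs))
  ... | x , x∈xs , px = x , x∈xs , to T-≡ px

  all-intro : ∀ xs → (∀ {x} → x ∈ xs → p x ≡ true) → all p xs ≡ true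
  all-intro xs pxs = to T-≡ (all⁻ p (All.tabulate (from T-≡ ∘ pxs)))

  filterᵇ-nonempty : ∀ xs → 0 < length (filterᵇ p xs) → ∃[ x ] p x ≡ true
  filterᵇ-nonempty (x ∷ xs) nonempty with p x in px
  ... | true  = x , px
  ... | false = filterᵇ-nonempty xs nonempty

  length-filterᵇ-++ : ∀ xs ys →
                      length (filterᵇ p (xs ++ ys)) ≡ length (filterᵇ p xs) + length (filterᵇ p ys)
  length-filterᵇ-++ xs ys = trans (cong length (filter-++ _ xs ys)) (length-++ (filterᵇ p xs))

module _ {A : Set} {p q : A → Bool} (p≗q : ∀ x → p x ≡ q x) where

  any-cong : ∀ xs → any p xs ≡ any q xs
  any-cong xs = cong or (map-cong p≗q xs)

  all-cong : ∀ xs → all p xs ≡ all q xs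
  all-cong xs = cong and (map-cong p≗q xs)

  filterᵇ-cong : ∀ xs → filterᵇ p xs ≡ filterᵇ q xs
  filterᵇ-cong []       = refl
  filterᵇ-cong (x ∷ xs) rewrite p≗q x with q x
  ... | true  = cong (x ∷_) (filterᵇ-cong xs)
  ... | false = filterᵇ-cong xs

module _ {A B : Set} where

  length-filterᵇ-map : (p : B → Bool) (g : A → B) (xs : List A) →
                       length (filterᵇ p (map g xs)) ≡ length (filterᵇ (p ∘ g) xs)
  length-filterᵇ-map p g []       = refl
  length-filterᵇ-map p g (x ∷ xs) with p (g x)
  ... | true  = cong suc (length-filterᵇ-map p g xs)
  ... | false = length-filterᵇ-map p g xs

  length-mapMaybe : (g : A → Maybe B) (p : A → Bool) → (∀ x → is-just (g x) ≡ p x) →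
                    (xs : List A) → length (mapMaybe g xs) ≡ length (filterᵇ p xs)
  length-mapMaybe g p g≗p []       = refl
  length-mapMaybe g p g≗p (x ∷ xs) with g x | p x | g≗p x
  ... | just _  | true  | _ = cong suc (length-mapMaybe g p g≗p xs)
  ... | nothing | false | _ = length-mapMaybe g p g≗p xs

module _ {A : Set} where

  sum-map-mono : ∀ {g h : A → ℕ} → (∀ x → g x ≤ h x) → ∀ xs → sum (map g xs) ≤ sum (map h xs)
  sum-map-mono g≤h []       = z≤n
  sum-map-mono g≤h (x ∷ xs) = +-mono-≤ (g≤h x) (sum-map-mono g≤h xs)

  sum-map-strict : ∀ {g h : A → ℕ} → (∀ x → g x ≤ h x) → ∀ {z xs} → z ∈ xs → g z < h z →
                   sum (map g xs) < sum (map h xs)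
  sum-map-strict g≤h {xs = _ ∷ xs} (here refl)  gz<hz = +-mono-<-≤ gz<hz (sum-map-mono g≤h xs)
  sum-map-strict g≤h {xs = x ∷ _}  (there z∈xs) gz<hz =
    +-mono-≤-< (g≤h x) (sum-map-strict g≤h z∈xs gz<hz)

  sum-map-bounded : ∀ {g : A → ℕ} {c} → (∀ x → g x ≤ c) → ∀ xs → sum (map g xs) ≤ length xs * c
  sum-map-bounded g≤c []       = z≤n
  sum-map-bounded g≤c (x ∷ xs) = +-mono-≤ (g≤c x) (sum-map-bounded g≤c xs)

module _ {A : Set} (xs : List A) (xs-complete : ∀ x → x ∈ xs)
         (grow : (A → Bool) → (A → Bool)) (grow-inflationary : ∀ R → R ⊆ᵇ grow R)
         (Inv : (A → Bool) → Set) (grow-preserves : ∀ R → Inv R → Inv (grow R)) where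

  private
    count : (A → Bool) → ℕ
    count R = sum (map (indicator ∘ R) xs)

    count≤length : ∀ R → count R ≤ length xs
    count≤length R = ≤-trans (sum-map-bounded (λ x → indicator≤1 (R x)) xs) (≤-reflexive (*-identityʳ _))
      where
      indicator≤1 : ∀ b → indicator b ≤ 1
      indicator≤1 true  = ≤-refl
      indicator≤1 false = z≤n

    count-grows : ∀ R {z} → z ∈ xs → R z ≡ false → grow R z ≡ true → count R < count (grow R)
    count-grows R z∈xs Rz≡false growRz≡true =
      sum-map-strict (λ x → indicator-mono (grow-inflationary R x)) z∈xs
        (subst₂ (λ a b → indicator a < indicator b) (sym Rz≡false) (sym growRz≡true) ≤-refl)
      where
      indicator-mono : ∀ {a b} → (a ≡ true → b ≡ true) → indicator a ≤ indicator b
      indicator-mono {false} _   = z≤n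
      indicator-mono {true}  a⇒b rewrite a⇒b refl = ≤-refl

    iterate : ∀ n R → Inv R → length xs < count R + n →
              Σ (A → Bool) λ R* → R ⊆ᵇ R* × Inv R* × grow R* ⊆ᵇ R*
    iterate zero R inv lt = ⊥-elim (<⇒≱ lt (≤-trans (≤-reflexive (+-identityʳ _)) (count≤length R)))
    iterate (suc n) R inv lt with Any.any? (λ z → (R z Bool.≟ false) ×-dec (grow R z Bool.≟ true)) xs
    ... | no nothing-new = R , (λ _ → id) , inv , closed
      where
      closed : grow R ⊆ᵇ R
      closed z growRz≡true with R z in Rz
      ... | true  = refl
      ... | false = ⊥-elim (nothing-new (lose (xs-complete z) (Rz , growRz≡true)))
    ... | yes new =
      let z , z∈xs , Rz≡false , growRz≡true = find new
          lt′ = ≤-trans lt (≤-trans (≤-reflexive (+-suc (count R) n))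
                                    (+-monoˡ-≤ n (count-grows R z∈xs Rz≡false growRz≡true)))
          R* , grow-R⊆R* , inv* , closed = iterate n (grow R) (grow-preserves R inv) lt′
      in R* , (λ x → grow-R⊆R* x ∘ grow-inflationary R x) , inv* , closed

  postfixpoint : ∀ R → Inv R → Σ (A → Bool) λ R* → R ⊆ᵇ R* × Inv R* × grow R* ⊆ᵇ R*
  postfixpoint R inv = iterate (suc (length xs)) R inv (≤-trans (n<1+n _) (m≤n+m _ (count R)))

m+n≡o⇒m≤o : ∀ {m n o} → m + n ≡ o → m ≤ o
m+n≡o⇒m≤o {m} {n} refl = m≤m+n m n

∣i-j∣≤1⇒i≤suc[j] : ∀ {i j} → ∣ i ℤ.- j ∣ ≤ 1 → i ℤ.≤ ℤ.suc j
∣i-j∣≤1⇒i≤suc[j] {i} {j} ∣i-j∣≤1 = begin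
  i                ≡⟨ i≡[i-j]+j i j ⟩
  (i ℤ.- j) ℤ.+ j  ≤⟨ ℤ.+-monoˡ-≤ j (ℤ.≤-trans (i≤+∣i∣ (i ℤ.- j)) (ℤ.+≤+ ∣i-j∣≤1)) ⟩
  1ℤ ℤ.+ j         ∎
  where
  open ℤ.≤-Reasoning
  i≡[i-j]+j : ∀ i j → i ≡ (i ℤ.- j) ℤ.+ j
  i≡[i-j]+j = solve-∀
  i≤+∣i∣ : ∀ i → i ℤ.≤ + ∣ i ∣
  i≤+∣i∣ (+ _)      = ℤ.≤-refl
  i≤+∣i∣ ℤ.-[1+ _ ] = ℤ.-≤+

[i-1]-j≡0 : ∀ {i j} → j ℤ.< i → ∣ i ℤ.- j ∣ ≤ 1 → (i ℤ.- 1ℤ) ℤ.- j ≡ 0ℤ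
[i-1]-j≡0 {i} {j} j<i ∣i-j∣≤1 = begin
  (i ℤ.- 1ℤ) ℤ.- j           ≡⟨ cong (λ t → (t ℤ.- 1ℤ) ℤ.- j) i≡suc[j] ⟩
  ((1ℤ ℤ.+ j) ℤ.- 1ℤ) ℤ.- j  ≡⟨ cancel j ⟩
  0ℤ                         ∎
  where
  open ≡-Reasoning
  i≡suc[j] : i ≡ ℤ.suc j
  i≡suc[j] = ℤ.≤-antisym (∣i-j∣≤1⇒i≤suc[j] ∣i-j∣≤1) (ℤ.i<j⇒suc[i]≤j j<i)
  cancel : ∀ j → ((1ℤ ℤ.+ j) ℤ.- 1ℤ) ℤ.- j ≡ 0ℤ
  cancel = solve-∀

j<i⇒0≤[i-1]-j : ∀ {i j} → j ℤ.< i → 0ℤ ℤ.≤ (i ℤ.- 1ℤ) ℤ.- j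
j<i⇒0≤[i-1]-j {i} j<i =
  ℤ.i≤j⇒0≤j-i (subst (_ ℤ.≤_) (ℤ.+-comm ℤ.-1ℤ i) (ℤ.i<j⇒i≤pred[j] j<i))

∣[i-1]-j∣+1≡∣i-j∣ : ∀ {i j} → j ℤ.< i → ∣ (i ℤ.- 1ℤ) ℤ.- j ∣ + 1 ≡ ∣ i ℤ.- j ∣
∣[i-1]-j∣+1≡∣i-j∣ {i} {j} j<i = ℤ.+-injective (begin
  + (∣ (i ℤ.- 1ℤ) ℤ.- j ∣ + 1)   ≡⟨ ℤ.pos-+ ∣ (i ℤ.- 1ℤ) ℤ.- j ∣ 1 ⟩
  + ∣ (i ℤ.- 1ℤ) ℤ.- j ∣ ℤ.+ 1ℤ  ≡⟨ cong (ℤ._+ 1ℤ) (ℤ.0≤i⇒+∣i∣≡i (j<i⇒0≤[i-1]-j j<i)) ⟩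
  ((i ℤ.- 1ℤ) ℤ.- j) ℤ.+ 1ℤ     ≡⟨ cancel i j ⟩
  i ℤ.- j                       ≡⟨ ℤ.0≤i⇒+∣i∣≡i (ℤ.i≤j⇒0≤j-i (ℤ.<⇒≤ j<i)) ⟨
  + ∣ i ℤ.- j ∣                 ∎)
  where
  open ≡-Reasoning
  cancel : ∀ i j → ((i ℤ.- 1ℤ) ℤ.- j) ℤ.+ 1ℤ ≡ i ℤ.- j
  cancel = solve-∀

private
  variable
    n : ℕ

hamming-refl : (u : Vec Bool n) → hamming u u ≡ 0
hamming-refl []          = refl
hamming-refl (true ∷ u)  = hamming-refl u
hamming-refl (false ∷ u) = hamming-refl u

hamming-sym : (u w : Vec Bool n) → hamming u w ≡ hamming w u
hamming-sym []          []          = refl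
hamming-sym (true ∷ u)  (true ∷ w)  = hamming-sym u w
hamming-sym (true ∷ u)  (false ∷ w) = cong suc (hamming-sym u w)
hamming-sym (false ∷ u) (true ∷ w)  = cong suc (hamming-sym u w)
hamming-sym (false ∷ u) (false ∷ w) = hamming-sym u w

hamming≡0⇒≡ : (u w : Vec Bool n) → hamming u w ≡ 0 → u ≡ w
hamming≡0⇒≡ []          []          _ = refl
hamming≡0⇒≡ (true ∷ u)  (true ∷ w)  h = cong (true ∷_) (hamming≡0⇒≡ u w h)
hamming≡0⇒≡ (false ∷ u) (false ∷ w) h = cong (false ∷_) (hamming≡0⇒≡ u w h)

hamming≤n : (u w : Vec Bool n) → hamming u w ≤ n
hamming≤n []          []          = z≤n
hamming≤n (true ∷ u)  (true ∷ w)  = m≤n⇒m≤1+n (hamming≤n u w)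
hamming≤n (true ∷ u)  (false ∷ w) = s≤s (hamming≤n u w)
hamming≤n (false ∷ u) (true ∷ w)  = s≤s (hamming≤n u w)
hamming≤n (false ∷ u) (false ∷ w) = m≤n⇒m≤1+n (hamming≤n u w)

hamming≡1⇒ones≢ : (u w : Vec Bool n) → hamming u w ≡ 1 → ones u ≢ ones w
hamming≡1⇒ones≢ []          []          ()
hamming≡1⇒ones≢ (true ∷ u)  (true ∷ w)  h eq = hamming≡1⇒ones≢ u w h (suc-injective eq)
hamming≡1⇒ones≢ (false ∷ u) (false ∷ w) h eq = hamming≡1⇒ones≢ u w h eq
hamming≡1⇒ones≢ (true ∷ u)  (false ∷ w) h eq
  rewrite hamming≡0⇒≡ u w (suc-injective h) = 1+n≢n eq
hamming≡1⇒ones≢ (false ∷ u) (true ∷ w)  h eq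
  rewrite hamming≡0⇒≡ u w (suc-injective h) = 1+n≢n (sym eq)

flip-up : (u v : Vec Bool n) → ones u ≤ ones v → u ≢ v →
          ∃[ m ] ones m ≡ suc (ones u) × hamming u m ≡ 1 × suc (hamming m v) ≡ hamming u v
flip-up []          []          _   u≢v = ⊥-elim (u≢v refl)
flip-up (false ∷ u) (true ∷ v)  _   _   = true ∷ u , refl , cong suc (hamming-refl u) , refl
flip-up (true ∷ u)  (true ∷ v)  u≤v u≢v with flip-up u v (≤-pred u≤v) (u≢v ∘ cong (true ∷_))
... | m , m-ones , u-m , m-v = true ∷ m , cong suc m-ones , u-m , m-v
flip-up (false ∷ u) (false ∷ v) u≤v u≢v with flip-up u v u≤v (u≢v ∘ cong (false ∷_))
... | m , m-ones , u-m , m-v = false ∷ m , m-ones , u-m , m-v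
flip-up (true ∷ u)  (false ∷ v) u<v _   with flip-up u v (<⇒≤ u<v) (λ { refl → <-irrefl refl u<v })
... | m , m-ones , u-m , m-v = true ∷ m , cong suc m-ones , u-m , cong suc m-v

flip-down : (m v : Vec Bool n) → ones v < ones m →
            ∃[ z ] suc (ones z) ≡ ones m × hamming m z ≡ 1 × suc (hamming z v) ≡ hamming m v
flip-down (true ∷ m)  (false ∷ v) _   = false ∷ m , refl , cong suc (hamming-refl m) , refl
flip-down (true ∷ m)  (true ∷ v)  v<m with flip-down m v (≤-pred v<m)
... | z , z-ones , m-z , z-v = true ∷ z , cong suc z-ones , m-z , z-v
flip-down (false ∷ m) (false ∷ v) v<m with flip-down m v v<m
... | z , z-ones , m-z , z-v = false ∷ z , z-ones , m-z , z-v
flip-down (false ∷ m) (true ∷ v)  v<m with flip-down m v (<-trans (n<1+n _) v<m)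
... | z , z-ones , m-z , z-v = false ∷ z , z-ones , m-z , cong suc z-v

∈-allVecs : (v : Vec Bool n) → v ∈ allVecs n
∈-allVecs []          = here refl
∈-allVecs (true ∷ v)  = ∈-++⁺ˡ (∈-map⁺ (true ∷_) (∈-allVecs v))
∈-allVecs (false ∷ v) = ∈-++⁺ʳ (map (true ∷_) (allVecs _)) (∈-map⁺ (false ∷_) (∈-allVecs v))

level-size-split : ∀ n k → length (filterᵇ (λ v → ones v ≡ᵇ k) (allVecs (suc n))) ≡
                   length (filterᵇ (λ v → suc (ones v) ≡ᵇ k) (allVecs n)) +
                   length (filterᵇ (λ v → ones v ≡ᵇ k) (allVecs n))
level-size-split n k = trans (length-filterᵇ-++ _ (map (true ∷_) (allVecs n)) _)
  (cong₂ _+_ (length-filterᵇ-map _ (true ∷_) (allVecs n)) (length-filterᵇ-map _ (false ∷_) (allVecs n)))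

level-size : ∀ n k → length (filterᵇ (λ v → ones v ≡ᵇ k) (allVecs n)) ≡ n C k
level-size zero    zero    = refl
level-size zero    (suc k) = refl
level-size (suc n) zero    =
  trans (level-size-split n 0) (cong₂ _+_ (none-of-weight-0 (allVecs n)) (level-size n 0))
  where
  none-of-weight-0 : (vs : List (Vec Bool n)) → length (filterᵇ (λ v → suc (ones v) ≡ᵇ 0) vs) ≡ 0
  none-of-weight-0 []       = refl
  none-of-weight-0 (_ ∷ vs) = none-of-weight-0 vs
level-size (suc n) (suc k) = begin
  length (filterᵇ (λ v → ones v ≡ᵇ suc k) (allVecs (suc n)))
    ≡⟨ level-size-split n (suc k) ⟩
  length (filterᵇ (λ v → ones v ≡ᵇ k) (allVecs n)) + length (filterᵇ (λ v → ones v ≡ᵇ suc k) (allVecs n))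
    ≡⟨ cong₂ _+_ (level-size n k) (level-size n (suc k)) ⟩
  n C k + n C suc k
    ≡⟨ nCk+nC[k+1]≡[n+1]C[k+1] n k ⟩
  suc n C suc k
    ∎
  where open ≡-Reasoning

dim-suc : ∀ e → dim (suc e) ≡ e + suc e
dim-suc e = cong (λ t → e + t) (+-identityʳ (suc e))

dim≤d² : ∀ {d} → 1 ≤ d → dim d ≤ d ^ 2
dim≤d² {suc e} _ = begin
  dim (suc e)        ≡⟨ dim-suc e ⟩
  e + suc e          ≡⟨ +-comm e (suc e) ⟩
  suc e + e          ≤⟨ +-monoʳ-≤ (suc e) (m≤m*n e (suc e)) ⟩
  suc e + e * suc e  ≡⟨ cong (suc e *_) (*-identityʳ (suc e)) ⟨
  suc e ^ 2          ∎
  where open ≤-Reasoning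

suc[d∸1]≡d : ∀ {d} → 1 ≤ d → suc (d ∸ 1) ≡ d
suc[d∸1]≡d (s≤s z≤n) = refl

module _ {d : ℕ} where

  Low-≡ : {x y : Low d} → proj₁ x ≡ proj₁ y → x ≡ y
  Low-≡ {_ , p} {_ , q} refl = cong (_ ,_) (≡-irrelevant p q)

  _≟ᴸ_ : DecidableEquality (Low d)
  x ≟ᴸ y = map′ Low-≡ (cong proj₁) (≡-dec Bool._≟_ (proj₁ x) (proj₁ y))

  toLow-proj₁ : (x : Low d) → toLow d (proj₁ x) ≡ just x
  toLow-proj₁ x with ones (proj₁ x) ≟ d ∸ 1
  ... | yes _  = cong just (Low-≡ refl)
  ... | no  ¬p = ⊥-elim (¬p (proj₂ x))

  ∈-lowList : (x : Low d) → x ∈ lowList d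
  ∈-lowList x = mapMaybe⁺ (toLow d) (allVecs (dim d)) (map⁺ (lose (∈-allVecs (proj₁ x))
    (subst (MaybeAny.Any (x ≡_)) (sym (toLow-proj₁ x)) (MaybeAny.just refl))))

  ∀-Low? : {P : Low d → Set} → (∀ x → Dec (P x)) → Dec (∀ x → P x)
  ∀-Low? P? = map′ (λ all-P x → All.lookup all-P (∈-lowList x)) (λ ∀P → All.tabulate λ {x} _ → ∀P x)
                   (All.all? P? (lowList d))

  is-just-toLow : ∀ v → is-just (toLow d v) ≡ (ones v ≡ᵇ d ∸ 1)
  is-just-toLow v with ones v ≟ d ∸ 1
  ... | yes p = sym (dec-true (ones v ≟ d ∸ 1) p)
  ... | no ¬p = sym (dec-false (ones v ≟ d ∸ 1) ¬p)

lowList-size : ∀ {d} → 1 ≤ d → length (lowList d) ≡ dim d C d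
lowList-size {suc e} _ = begin
  length (lowList (suc e))       ≡⟨ length-mapMaybe (toLow (suc e)) _ is-just-toLow (allVecs (dim (suc e))) ⟩
  length (filterᵇ (λ v → ones v ≡ᵇ e) (allVecs (dim (suc e))))
                                 ≡⟨ level-size (dim (suc e)) e ⟩
  dim (suc e) C e                ≡⟨ cong (_C e) (dim-suc e) ⟩
  (e + suc e) C e                ≡⟨ nCk≡nC[n∸k] (m≤m+n e (suc e)) ⟩
  (e + suc e) C (e + suc e ∸ e)  ≡⟨ cong₂ _C_ (sym (dim-suc e)) (m+n∸m≡n e (suc e)) ⟩
  dim (suc e) C suc e            ∎
  where open ≡-Reasoning

Dist2ᴸ DistLe2ᴸ : ∀ d → Low d → Low d → Set
Dist2ᴸ   d x y = Dist2 d (low→mid d x) (low→mid d y)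
DistLe2ᴸ d x y = DistLe2 d (low→mid d x) (low→mid d y)

module _ {d : ℕ} where

  inMidᵇ-complete : ∀ v → InMid d v → inMidᵇ d v ≡ true
  inMidᵇ-complete v (inj₁ p) = ∨-introˡ (ones v ≡ᵇ d) (≡ᵇ-complete p)
  inMidᵇ-complete v (inj₂ p) = ∨-introʳ (ones v ≡ᵇ d ∸ 1) (≡ᵇ-complete p)

  inMidᵇ-sound : ∀ v → inMidᵇ d v ≡ true → InMid d v
  inMidᵇ-sound v p with ∨-elim {ones v ≡ᵇ d ∸ 1} p
  ... | inj₁ q = inj₁ (≡ᵇ-sound q)
  ... | inj₂ q = inj₂ (≡ᵇ-sound q)

  NB-intro : ∀ (K : LowSet d) {x w} → K x ≡ true → InMid d w → hamming (proj₁ x) w ≡ 1 →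
             NBᵇ d K w ≡ true
  NB-intro K {x} {w} Kx w-mid x-w = ∧-intro (inMidᵇ-complete w w-mid)
    (any-intro (λ x′ → K x′ ∧ adjᵇ d (proj₁ x′) w) (∈-lowList {d} x)
      (∧-intro Kx (≡ᵇ-complete x-w)))

  N2-intro : ∀ (K : LowSet d) {x y} (m : Mid d) → K x ≡ true →
             Adj d (low→mid d x) m → Adj d m (low→mid d y) → N2ᵇ d K y ≡ true
  N2-intro K {y = y} (m , m-mid) Kx x-m m-y =
    any-intro (λ w → NBᵇ d K w ∧ adjᵇ d w (proj₁ y)) (∈-allVecs m)
      (∧-intro (NB-intro K Kx m-mid x-m) (≡ᵇ-complete m-y))

  N2-elim : ∀ (K : LowSet d) {y} → N2ᵇ d K y ≡ true →
            ∃[ x ] Σ (Mid d) λ m → K x ≡ true × Adj d (low→mid d x) m × Adj d m (low→mid d y)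
  N2-elim K {y} N2y with any-elim (λ w → NBᵇ d K w ∧ adjᵇ d w (proj₁ y)) (allVecs (dim d)) N2y
  ... | m , _ , NBm∧m-y with ∧-elim {NBᵇ d K m} NBm∧m-y
  ...   | NBm , m-y with ∧-elim {inMidᵇ d m} NBm
  ...     | m-mid , ∃x with any-elim (λ x → K x ∧ adjᵇ d (proj₁ x) m) (lowList d) ∃x
  ...       | x , _ , Kx∧x-m with ∧-elim {K x} Kx∧x-m
  ...         | Kx , x-m = x , (m , inMidᵇ-sound m m-mid) , Kx , ≡ᵇ-sound x-m , ≡ᵇ-sound m-y

  ⊆-closure : (K : LowSet d) → K ⊆ᵇ closure d K
  ⊆-closure K v Kv =
    all-intro (λ w → not (inMidᵇ d w ∧ adjᵇ d (proj₁ v) w) ∨ NBᵇ d K w) (allVecs (dim d))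
      λ {w} _ → neighbour-covered w
    where
    neighbour-covered : ∀ w → not (inMidᵇ d w ∧ adjᵇ d (proj₁ v) w) ∨ NBᵇ d K w ≡ true
    neighbour-covered w with inMidᵇ d w ∧ adjᵇ d (proj₁ v) w in v-w
    ... | false = refl
    ... | true  = let w-mid , v-w′ = ∧-elim {inMidᵇ d w} v-w
                  in NB-intro K Kv (inMidᵇ-sound w w-mid) (≡ᵇ-sound v-w′)

  DistLe2ᴸ-sym : ∀ {x y} → DistLe2ᴸ d x y → DistLe2ᴸ d y x
  DistLe2ᴸ-sym (inj₁ x≡y) = inj₁ (sym x≡y)
  DistLe2ᴸ-sym {x} {y} (inj₂ (inj₁ x-y)) = inj₂ (inj₁ (trans (hamming-sym (proj₁ y) (proj₁ x)) x-y))
  DistLe2ᴸ-sym {x} {y} (inj₂ (inj₂ ((m , m-mid) , x-m , m-y))) =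
    inj₂ (inj₂ ((m , m-mid) , trans (hamming-sym (proj₁ y) m) m-y , trans (hamming-sym m (proj₁ x)) x-m))

  Dist2ᴸ-sym : ∀ {x y} → Dist2ᴸ d x y → Dist2ᴸ d y x
  Dist2ᴸ-sym {x} {y} (x≢y , x≁y , (m , m-mid) , x-m , m-y) =
      x≢y ∘ sym
    , x≁y ∘ trans (hamming-sym (proj₁ x) (proj₁ y))
    , (m , m-mid) , trans (hamming-sym (proj₁ y) m) m-y , trans (hamming-sym m (proj₁ x)) x-m

  -- Two vertices of one level are never adjacent.
  DistLe2ᴸ-cases : ∀ {x y} → DistLe2ᴸ d x y →
                   x ≡ y ⊎ Σ (Mid d) λ m → Adj d (low→mid d x) m × Adj d m (low→mid d y)
  DistLe2ᴸ-cases (inj₁ x≡y)                = inj₁ (Low-≡ {d} x≡y)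
  DistLe2ᴸ-cases {x} {y} (inj₂ (inj₁ x-y)) =
    ⊥-elim (hamming≡1⇒ones≢ (proj₁ x) (proj₁ y) x-y (trans (proj₂ x) (sym (proj₂ y))))
  DistLe2ᴸ-cases (inj₂ (inj₂ path))        = inj₂ path

  module _ {K K′ : LowSet d} (K≗K′ : ∀ x → K x ≡ K′ x) where

    NB-cong : ∀ w → NBᵇ d K w ≡ NBᵇ d K′ w
    NB-cong w =
      cong (inMidᵇ d w ∧_) (any-cong (λ x → cong (_∧ adjᵇ d (proj₁ x) w) (K≗K′ x)) (lowList d))

    N2-cong : ∀ y → N2ᵇ d K y ≡ N2ᵇ d K′ y
    N2-cong y = any-cong (λ w → cong (_∧ adjᵇ d w (proj₁ y)) (NB-cong w)) (allVecs (dim d))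

    closure-cong : ∀ v → closure d K v ≡ closure d K′ v
    closure-cong v =
      all-cong (λ w → cong (not (inMidᵇ d w ∧ adjᵇ d (proj₁ v) w) ∨_) (NB-cong w)) (allVecs (dim d))

    size-cong : size d K ≡ size d K′
    size-cong = cong length (filterᵇ-cong K≗K′ (lowList d))

data Walk (d : ℕ) : Low d → Low d → ℕ → Set where
  []  : ∀ {x} → Walk d x x 0
  _∷_ : ∀ {x y z k} → Dist2ᴸ d x y → Walk d y z k → Walk d x z (suc k)

module _ {d : ℕ} (1≤d : 1 ≤ d) where

  -- Flip a coordinate where x is 0 and y is 1, then one where x is 1 and y is 0.
  step-towards : (x y : Low d) → x ≢ y →
                 ∃[ z ] Dist2ᴸ d x z × 2 + hamming (proj₁ z) (proj₁ y) ≡ hamming (proj₁ x) (proj₁ y)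
  step-towards (x , x-low) (y , y-low) x≢y
    with flip-up x y (≤-reflexive (trans x-low (sym y-low))) (x≢y ∘ Low-≡ {d})
  ... | m , m-ones , x-m , m-y
    with flip-down m y (subst (ones y <_) (sym m-ones) (≤-reflexive (cong suc (trans y-low (sym x-low)))))
  ...   | z , z-ones , m-z , z-y = (z , z-low) , x~z , z-y-x
    where
    z-low : ones z ≡ d ∸ 1
    z-low = trans (suc-injective (trans z-ones m-ones)) x-low
    z-y-x : 2 + hamming z y ≡ hamming x y
    z-y-x = trans (cong suc z-y) m-y
    x~z : Dist2ᴸ d (x , x-low) (z , z-low)
    x~z = (λ { refl → m≢1+n+m (hamming x y) (sym z-y-x) })
        , (λ x-z → hamming≡1⇒ones≢ x z x-z (trans x-low (sym z-low)))
        , (m , inj₂ (trans m-ones (trans (cong suc x-low) (suc[d∸1]≡d 1≤d)))) , x-m , m-z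

  walk-between : ∀ n (x y : Low d) → hamming (proj₁ x) (proj₁ y) ≤ n → ∃[ k ] k ≤ n × Walk d x y k
  walk-between zero x y x-y≤0 with Low-≡ {d} {x} {y} (hamming≡0⇒≡ _ _ (n≤0⇒n≡0 x-y≤0))
  ... | refl = 0 , z≤n , []
  walk-between (suc n) x y x-y≤1+n with _≟ᴸ_ {d} x y
  ... | yes refl = 0 , z≤n , []
  ... | no x≢y with step-towards x y x≢y
  ...   | z , x~z , z-y-x
    with walk-between n z y (≤-pred (≤-trans (n≤1+n _) (subst (_≤ suc n) (sym z-y-x) x-y≤1+n)))
  ...     | k , k≤n , z⇝y = suc k , s≤s k≤n , x~z ∷ z⇝y

module _ {d : ℕ} where

  legal-walk : ∀ {f x y k} → Legal d f → Walk d x y k → f x ℤ.≤ f y ℤ.+ + k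
  legal-walk {f} {x} legal [] = ℤ.≤-reflexive (sym (ℤ.+-identityʳ (f x)))
  legal-walk {f} {x} {y} {suc k} legal (_∷_ {y = z} x~z z⇝y) = begin
    f x                     ≤⟨ ∣i-j∣≤1⇒i≤suc[j] (legal x z x~z) ⟩
    1ℤ ℤ.+ f z              ≤⟨ ℤ.+-monoʳ-≤ 1ℤ (legal-walk {f} legal z⇝y) ⟩
    1ℤ ℤ.+ (f y ℤ.+ + k)    ≡⟨ shuffle (f y) (+ k) ⟩
    f y ℤ.+ (1ℤ ℤ.+ + k)    ∎
    where
    open ℤ.≤-Reasoning
    shuffle : ∀ a b → 1ℤ ℤ.+ (a ℤ.+ b) ≡ a ℤ.+ (1ℤ ℤ.+ b)
    shuffle = solve-∀

  walk-exit : ∀ (K : LowSet d) {x y k} → Walk d x y k → K x ≡ true → K y ≡ false →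
              ∃[ b ] N2ᵇ d K b ≡ true × K b ≡ false
  walk-exit K [] Kx Ky = ⊥-elim (true≢false (trans (sym Kx) Ky))
  walk-exit K {x} (_∷_ {y = z} (_ , _ , m , x-m , m-z) z⇝y) Kx Ky with K z in Kz
  ... | false = z , N2-intro K {x} {z} m Kx x-m m-z , Kz
  ... | true  = walk-exit K z⇝y Kz Ky

lower : ∀ d → LowSet d → Labeling d → Labeling d
lower d K f x = if K x then f x ℤ.- 1ℤ else f x

module _ {d : ℕ} where

  exit-drops-by-one : ∀ {f K} → Legal d f → MaxComponent d f K → ∀ {x y} →
                      K x ≡ true → K y ≡ false → Dist2ᴸ d x y → (f x ℤ.- 1ℤ) ℤ.- f y ≡ 0ℤ
  exit-drops-by-one {K = K} legal (_ , above) {x} {y} Kx Ky x~y@(_ , _ , m , x-m , m-y) =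
    [i-1]-j≡0 (above x y Kx (N2-intro K {x} {y} m Kx x-m m-y) Ky) (legal x y x~y)

  legal-lower : ∀ {f K} → Legal d f → MaxComponent d f K → Legal d (lower d K f)
  legal-lower {f} {K} legal max u w u~w with K u in Ku | K w in Kw
  ... | true  | true  = subst (λ i → ∣ i ∣ ≤ 1) (sym (cancel (f u) (f w))) (legal u w u~w)
    where
    cancel : ∀ a b → (a ℤ.- 1ℤ) ℤ.- (b ℤ.- 1ℤ) ≡ a ℤ.- b
    cancel = solve-∀
  ... | false | false = legal u w u~w
  ... | true  | false = subst (λ i → ∣ i ∣ ≤ 1) (sym (exit-drops-by-one legal max Ku Kw u~w)) z≤n
  ... | false | true  = subst (_≤ 1) (ℤ.∣i-j∣≡∣j-i∣ (f w ℤ.- 1ℤ) (f u))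
      (subst (λ i → ∣ i ∣ ≤ 1)
        (sym (exit-drops-by-one legal max Kw Ku (Dist2ᴸ-sym {x = u} {y = w} u~w))) z≤n)

  merge-shift : ∀ {v₀ K f} x → merge d v₀ K f x ≡ lower d K f x ℤ.+ + indicator (K v₀)
  merge-shift {v₀} {K} {f} x with K v₀ | K x
  ... | false | true  = sym (ℤ.+-identityʳ (f x ℤ.- 1ℤ))
  ... | false | false = sym (ℤ.+-identityʳ (f x))
  ... | true  | true  = i≡[i-1]+1 (f x)
    where
    i≡[i-1]+1 : ∀ i → i ≡ (i ℤ.- 1ℤ) ℤ.+ 1ℤ
    i≡[i-1]+1 = solve-∀
  ... | true  | false = refl

  merge-diff : ∀ {v₀ K f} x y → merge d v₀ K f x ℤ.- merge d v₀ K f y ≡ lower d K f x ℤ.- lower d K f y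
  merge-diff {v₀} {K} {f} x y =
    trans (cong₂ ℤ._-_ (merge-shift {v₀} {K} {f} x) (merge-shift {v₀} {K} {f} y))
          (cancel (lower d K f x) (lower d K f y) (+ indicator (K v₀)))
    where
    cancel : ∀ a b c → (a ℤ.+ c) ℤ.- (b ℤ.+ c) ≡ a ℤ.- b
    cancel = solve-∀

  legal-merge : ∀ {v₀ K f} → Legal d f → MaxComponent d f K → Legal d (merge d v₀ K f)
  legal-merge {v₀} {K} {f} legal max u w u~w =
    subst (λ i → ∣ i ∣ ≤ 1) (sym (merge-diff {v₀} {K} {f} u w)) (legal-lower legal max u w u~w)

  merge-centered : ∀ {v₀ K f} → Centered d v₀ f → Centered d v₀ (merge d v₀ K f)
  merge-centered {v₀} {K} centered with K v₀
  ... | true  = centered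
  ... | false = centered

IsMinimum : ∀ d → Labeling d → Low d → Set
IsMinimum d f w = ∀ x → f w ℤ.≤ f x

potential : ∀ d → Low d → Labeling d → ℕ
potential d w f = sum (map (λ x → ∣ f x ℤ.- f w ∣) (lowList d))

height≤dim : ∀ {d} → 1 ≤ d → ∀ {f w} → Legal d f → IsMinimum d f w →
             ∀ x → ∣ f x ℤ.- f w ∣ ≤ dim d
height≤dim {d} 1≤d {f} {w} legal w-min x with walk-between 1≤d (dim d) x w (hamming≤n (proj₁ x) (proj₁ w))
... | k , k≤dim , x⇝w = ≤-trans (ℤ.drop‿+≤+ (begin
  + ∣ f x ℤ.- f w ∣      ≡⟨ ℤ.0≤i⇒+∣i∣≡i (ℤ.i≤j⇒0≤j-i (w-min x)) ⟩
  f x ℤ.- f w            ≤⟨ ℤ.+-monoˡ-≤ (ℤ.- f w) (legal-walk {f = f} legal x⇝w) ⟩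
  (f w ℤ.+ + k) ℤ.- f w  ≡⟨ cancel (f w) (+ k) ⟩
  + k                    ∎)) k≤dim
  where
  open ℤ.≤-Reasoning
  cancel : ∀ a b → (a ℤ.+ b) ℤ.- a ≡ b
  cancel = solve-∀

potential-bound : ∀ {d} → 1 ≤ d → ∀ {f w} → Legal d f → IsMinimum d f w →
                  potential d w f ≤ d ^ 2 * (dim d C d)
potential-bound {d} 1≤d {f} {w} legal w-min = begin
  potential d w f             ≤⟨ sum-map-bounded (height≤dim 1≤d legal w-min) (lowList d) ⟩
  length (lowList d) * dim d  ≡⟨ cong (_* dim d) (lowList-size 1≤d) ⟩
  (dim d C d) * dim d         ≡⟨ *-comm (dim d C d) (dim d) ⟩
  dim d * (dim d C d)         ≤⟨ *-monoˡ-≤ (dim d C d) (dim≤d² 1≤d) ⟩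
  d ^ 2 * (dim d C d)         ∎
  where open ≤-Reasoning

module MergeStep {d : ℕ} (1≤d : 1 ≤ d) {f : Labeling d} {K : LowSet d} (big : BigMaxComponent d f K) where

  size-positive : 0 < size d K
  size-positive with size d K | proj₁ (proj₂ big)
  ... | zero  | d≤0 = ⊥-elim (<⇒≱ 1≤d d≤0)
  ... | suc _ | _   = s≤s z≤n

  member : ∃[ x ] K x ≡ true
  member = filterᵇ-nonempty K (lowList d) size-positive

  non-member : ∃[ y ] K y ≡ false
  non-member with Any.any? (λ y → K y Bool.≟ false) (lowList d)
  ... | yes some = let y , _ , Ky = find some in y , Ky
  ... | no none  =
    ⊥-elim (<⇒≱ (∈-length (∈-lowList {d} (proj₁ member))) (+-cancelʳ-≤ (9 * N) N 0 10N≤9N))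
    where
    N = length (lowList d)
    everything : ∀ y → K y ≡ true
    everything y with K y in Ky
    ... | true  = refl
    ... | false = ⊥-elim (none (lose (∈-lowList {d} y) Ky))
    [K]-everything : size d (closure d K) ≡ N
    [K]-everything = cong length (filter-all (T? ∘ closure d K) {lowList d}
                       (All.tabulate λ {y} _ → from T-≡ (⊆-closure {d} K y (everything y))))
    10N≤9N : 10 * N ≤ 9 * N
    10N≤9N = subst₂ (λ a b → 10 * a ≤ 9 * b) [K]-everything (sym (lowList-size 1≤d)) (proj₂ (proj₂ big))

  exit : ∃[ b ] N2ᵇ d K b ≡ true × K b ≡ false
  exit with member | non-member
  ... | x , Kx | y , Ky with walk-between 1≤d (dim d) x y (hamming≤n (proj₁ x) (proj₁ y))
  ...   | _ , _ , x⇝y = walk-exit K x⇝y Kx Ky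

  module _ (v₀ : Low d) {w : Low d} (w-min : IsMinimum d f w) where

    above-w : ∀ x → K x ≡ true → f w ℤ.< f x
    above-w x Kx = let b , N2b , Kb = exit in ℤ.≤-<-trans (w-min b) (proj₂ (proj₁ big) x b Kx N2b Kb)

    w∉K : K w ≡ false
    w∉K with K w in Kw
    ... | false = refl
    ... | true  = ⊥-elim (ℤ.<-irrefl refl (above-w w Kw))

    merge-min : IsMinimum d (merge d v₀ K f) w
    merge-min x = ℤ.0≤i-j⇒j≤i (subst (0ℤ ℤ.≤_) (sym (merge-diff {d} {v₀} {K} {f} x w)) (nonneg x))
      where
      nonneg : ∀ x → 0ℤ ℤ.≤ lower d K f x ℤ.- lower d K f w
      nonneg x rewrite w∉K with K x in Kx
      ... | true  = j<i⇒0≤[i-1]-j (above-w x Kx)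
      ... | false = ℤ.i≤j⇒0≤j-i (w-min x)

    merged-height : ∀ x → ∣ merge d v₀ K f x ℤ.- merge d v₀ K f w ∣ + indicator (K x) ≡
                          ∣ f x ℤ.- f w ∣
    merged-height x =
      trans (cong (λ i → ∣ i ∣ + indicator (K x)) (merge-diff {d} {v₀} {K} {f} x w)) (lowered x)
      where
      lowered : ∀ x → ∣ lower d K f x ℤ.- lower d K f w ∣ + indicator (K x) ≡ ∣ f x ℤ.- f w ∣
      lowered x rewrite w∉K with K x in Kx
      ... | true  = ∣[i-1]-j∣+1≡∣i-j∣ (above-w x Kx)
      ... | false = +-identityʳ _

    potential-decreases : potential d w (merge d v₀ K f) < potential d w f
    potential-decreases = sum-map-strict (λ x → m+n≡o⇒m≤o (merged-height x)) (∈-lowList {d} x₁) h′<h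
      where
      x₁ = proj₁ member
      h′ = ∣ merge d v₀ K f x₁ ℤ.- merge d v₀ K f w ∣
      h′<h : h′ < ∣ f x₁ ℤ.- f w ∣
      h′<h = subst (_≤ ∣ f x₁ ℤ.- f w ∣) (+-comm h′ 1)
               (≤-reflexive (trans (cong (λ b → h′ + indicator b) (sym (proj₂ member))) (merged-height x₁)))

ClosedUnder : ∀ d → LowSet d → LowSet d → Set
ClosedUnder d P K = ∀ c z → P c ≡ true → DistLe2ᴸ d c z → K z ≡ true → P z ≡ true

module _ {d : ℕ} where

  chain-mono : ∀ {K K′ : LowSet d} → K ⊆ᵇ K′ → ∀ {x y} → Chain d K x y → Chain d K′ x y
  chain-mono K⊆K′ done              = done
  chain-mono K⊆K′ (step x~z Kz z⇝y) = step x~z (K⊆K′ _ Kz) (chain-mono K⊆K′ z⇝y)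

  chain-++ : ∀ {K x y z} → Chain d K x y → Chain d K y z → Chain d K x z
  chain-++ done              y⇝z = y⇝z
  chain-++ (step x~u Ku u⇝y) y⇝z = step x~u Ku (chain-++ u⇝y y⇝z)

  chain-reverse : ∀ {K x y} → K x ≡ true → Chain d K x y → Chain d K y x
  chain-reverse Kx x⇝y = go Kx x⇝y done
    where
    go : ∀ {K a x y} → K a ≡ true → Chain d K a y → Chain d K a x → Chain d K y x
    go Ka done a⇝x = a⇝x
    go {a = a} Ka (step {z = u} a~u Ku u⇝y) a⇝x = go Ku u⇝y (step (DistLe2ᴸ-sym {x = a} {y = u} a~u) Ka a⇝x)

  chain-restrict : ∀ {P K} → ClosedUnder d P K → ∀ {x y} → P x ≡ true → Chain d K x y → Chain d P x y
  chain-restrict closed Px done              = done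
  chain-restrict closed Px (step x~z Kz z⇝y) =
    let Pz = closed _ _ Px x~z Kz in step x~z Pz (chain-restrict closed Pz z⇝y)

  chain-end : ∀ {P x y} → P x ≡ true → Chain d P x y → P y ≡ true
  chain-end Px done            = Px
  chain-end Px (step _ Pz z⇝y) = chain-end Pz z⇝y

module _ {d : ℕ} (f : Labeling d) where

  bigMaxComponent? : ∀ K → TwoLinked d K → Dec (BigMaxComponent d f K)
  bigMaxComponent? K twoLinked =
    (yes twoLinked ×-dec above?) ×-dec (d ≤? 2 * size d K) ×-dec (10 * size d (closure d K) ≤? 9 * (dim d C d))
    where
    above? = ∀-Low? {d} λ x → ∀-Low? {d} λ y →
      (K x Bool.≟ true) →-dec (N2ᵇ d K y Bool.≟ true) →-dec (K y Bool.≟ false) →-dec (f y ℤ.<? f x)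

  bigMaxComponent-cong : ∀ {K K′} → (∀ x → K x ≡ K′ x) →
                         BigMaxComponent d f K → BigMaxComponent d f K′
  bigMaxComponent-cong {K} {K′} K≗K′ ((twoLinked , above) , d≤2|K| , 10|[K]|≤9C) =
      ( (λ x y K′x K′y → chain-mono (λ z Kz → trans (sym (K≗K′ z)) Kz)
                           (twoLinked x y (K′⇒K x K′x) (K′⇒K y K′y)))
      , (λ x y K′x N2y K′y → above x y (K′⇒K x K′x) (trans (N2-cong {d} K≗K′ y) N2y) (trans (K≗K′ y) K′y)) )
    , subst (λ s → d ≤ 2 * s) (size-cong {d} K≗K′) d≤2|K|
    , subst (λ s → 10 * s ≤ 9 * (dim d C d)) (size-cong {d} (closure-cong {d} K≗K′)) 10|[K]|≤9C
    where
    K′⇒K : ∀ x → K′ x ≡ true → K x ≡ true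
    K′⇒K x = trans (K≗K′ x)

module Components {d : ℕ} (f : Labeling d) where

  Above : Low d → LowSet d
  Above x₀ z = does (f x₀ ℤ.≤? f z)

  grow : Low d → LowSet d → LowSet d
  grow x₀ R z = R z ∨ (Above x₀ z ∧ N2ᵇ d R z)

  Reachable : Low d → LowSet d → Set
  Reachable x₀ R = ∀ z → R z ≡ true → Chain d (Above x₀) x₀ z

  private
    grow-reachable : ∀ x₀ R → Reachable x₀ R → Reachable x₀ (grow x₀ R)
    grow-reachable x₀ R reach z Rz∨… with ∨-elim {R z} Rz∨…
    ... | inj₁ Rz = reach z Rz
    ... | inj₂ Az∧N2z with ∧-elim {Above x₀ z} Az∧N2z
    ...   | Az , N2z with N2-elim R {z} N2z
    ...     | y , m , Ry , y-m , m-z = chain-++ (reach y Ry) (step (inj₂ (inj₂ (m , y-m , m-z))) Az done)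

    singleton : Low d → LowSet d
    singleton x₀ z = does (_≟ᴸ_ {d} z x₀)

    component-spec : ∀ x₀ → Σ (LowSet d) λ R → singleton x₀ ⊆ᵇ R × Reachable x₀ R × grow x₀ R ⊆ᵇ R
    component-spec x₀ =
      postfixpoint (lowList d) (∈-lowList {d}) (grow x₀) (λ R z → ∨-introˡ (Above x₀ z ∧ N2ᵇ d R z))
        (Reachable x₀) (grow-reachable x₀) (singleton x₀) singleton-reachable
      where
      singleton-reachable : Reachable x₀ (singleton x₀)
      singleton-reachable z z≡x₀ with does-sound (_≟ᴸ_ {d} z x₀) z≡x₀
      ... | refl = done

  -- The 2-linked component of x₀ in {z : f x₀ ≤ f z}.  Opaque: unfolding the fixpoint
  -- iteration during unification makes type checking very slow.
  opaque
    component : Low d → LowSet d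
    component x₀ = proj₁ (component-spec x₀)

    component-∋ : ∀ x₀ → component x₀ x₀ ≡ true
    component-∋ x₀ = proj₁ (proj₂ (component-spec x₀)) x₀ (dec-true (_≟ᴸ_ {d} x₀ x₀) refl)

    component-reachable : ∀ x₀ → Reachable x₀ (component x₀)
    component-reachable x₀ = proj₁ (proj₂ (proj₂ (component-spec x₀)))

    grow-component : ∀ x₀ → grow x₀ (component x₀) ⊆ᵇ component x₀
    grow-component x₀ = proj₂ (proj₂ (proj₂ (component-spec x₀)))

  component-closed : ∀ x₀ → ClosedUnder d (component x₀) (Above x₀)
  component-closed x₀ c z Cc c~z Az with DistLe2ᴸ-cases {x = c} {y = z} c~z
  ... | inj₁ refl = Cc
  ... | inj₂ (m , c-m , m-z) =
    grow-component x₀ z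
      (∨-introʳ (component x₀ z) (∧-intro Az (N2-intro (component x₀) {c} {z} m Cc c-m m-z)))

  component-twoLinked : ∀ x₀ → TwoLinked d (component x₀)
  component-twoLinked x₀ a b Ca Cb = chain-++ (chain-reverse (component-∋ x₀) (within a Ca)) (within b Cb)
    where
    within : ∀ z → component x₀ z ≡ true → Chain d (component x₀) x₀ z
    within z Cz = chain-restrict (component-closed x₀) (component-∋ x₀) (component-reachable x₀ z Cz)

  maxComponent≗component : ∀ {K x₁} → MaxComponent d f K → K x₁ ≡ true →
                           ∃[ w ] ∀ z → K z ≡ component w z
  maxComponent≗component {K} {x₁} (twoLinked , above) Kx₁ = w , ⊆ᵇ-antisym K⊆C C⊆K
    where
    members = filterᵇ K (lowList d)
    w = argmin f x₁ members
    Kw : K w ≡ true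
    Kw = argmin-all f Kx₁ (All.map (to T-≡) (all-filter (T? ∘ K) (lowList d)))
    w-lowest : ∀ z → K z ≡ true → f w ℤ.≤ f z
    w-lowest z Kz =
      All.lookup (f[argmin]≤f[xs] x₁ members) (∈-filter⁺ (T? ∘ K) (∈-lowList {d} z) (from T-≡ Kz))
    K⊆C : K ⊆ᵇ component w
    K⊆C z Kz = chain-end (component-∋ w) (chain-restrict (component-closed w) (component-∋ w)
                 (chain-mono (λ u Ku → dec-true (f w ℤ.≤? f u) (w-lowest u Ku)) (twoLinked w z Kw Kz)))
    K-closed : ClosedUnder d K (Above w)
    K-closed c z Kc c~z Az with K z in Kz | DistLe2ᴸ-cases {x = c} {y = z} c~z
    ... | true  | _                    = refl
    ... | false | inj₁ refl            = ⊥-elim (true≢false (trans (sym Kc) Kz))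
    ... | false | inj₂ (m , c-m , m-z) =
      ⊥-elim (ℤ.<⇒≱ (above w z Kw (N2-intro K {c} {z} m Kc c-m m-z) Kz) (does-sound (f w ℤ.≤? f z) Az))
    C⊆K : component w ⊆ᵇ K
    C⊆K z Cz = chain-end Kw (chain-restrict K-closed Kw (component-reachable w z Cz))

  maxGood? : 1 ≤ d → (Σ (LowSet d) λ K → BigMaxComponent d f K) ⊎ MaxGood d f
  maxGood? 1≤d with Any.any? (λ x → bigMaxComponent? f (component x) (component-twoLinked x)) (lowList d)
  ... | yes some = let x , _ , big = find some in inj₁ (component x , big)
  ... | no none  = inj₂ λ K big →
    let w , K≗Cw = maxComponent≗component (proj₁ big) (proj₂ (MergeStep.member 1≤d big))
    in none (lose (∈-lowList {d} w) (bigMaxComponent-cong f K≗Cw big))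

module _ {d : ℕ} (1≤d : 1 ≤ d) (v₀ : Low d) where

  descend : ∀ n {f w} → Centered d v₀ f → Legal d f → IsMinimum d f w → potential d w f ≤ n →
            ∃[ ℓ ] ℓ ≤ n × F d v₀ ℓ f
  descend n {f} {w} centered legal w-min bounded with Components.maxGood? f 1≤d
  ... | inj₂ good      = 0 , z≤n , base (centered , legal , good)
  ... | inj₁ (K , big) = merge-and-descend n bounded
    where
    open MergeStep 1≤d big
    merge-and-descend : ∀ n → potential d w f ≤ n → ∃[ ℓ ] ℓ ≤ n × F d v₀ ℓ f
    merge-and-descend zero    bounded = ⊥-elim (n≮0 (≤-trans (potential-decreases v₀ w-min) bounded))
    merge-and-descend (suc n) bounded =
      let ℓ , ℓ≤n , Fℓ = descend n {merge d v₀ K f} {w} (merge-centered {d} {v₀} {K} {f} centered)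
                           (legal-merge legal (proj₁ big)) (merge-min v₀ w-min)
                           (≤-pred (≤-trans (potential-decreases v₀ w-min) bounded))
      in suc ℓ , s≤s ℓ≤n , mstep K big Fℓ

lemma7p4 : (d : ℕ) → 1 ≤ d → (v₀ : Low d) → (f : Labeling d) →
           Centered d v₀ f → Legal d f →
           Σ ℕ (λ ℓ → ℓ ≤ d ^ 2 * (dim d C d) × F d v₀ ℓ f)
lemma7p4 d 1≤d v₀ f centered legal =
  descend 1≤d v₀ (d ^ 2 * (dim d C d)) {f} {w} centered legal w-min (potential-bound 1≤d {f} {w} legal w-min)
  where
  w = argmin f v₀ (lowList d)
  w-min : IsMinimum d f w
  w-min x = All.lookup (f[argmin]≤f[xs] v₀ (lowList d)) (∈-lowList {d} x)
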